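{- Let $F$ be a finite field with $q$ elements and let $V$ be a vector space over $F$ of finite dimension $n\ge 1$. Then the edge connectivity of the linear dependence graph $\Gamma(V)$ is $q-1$.
   Context: For a finite-dimensional vector space $V$ over a finite field $F$, the linear dependence graph $\Gamma(V)$ is the simple graph whose vertex set is $V$, two vertices $a,b$ being adjacent if and only if $a\neq b$ and $\{a,b\}$ is linearly dependent. The edge connectivity of a graph is the minimum number of edges whose removal disconnects it. -}

module Defs where

open import Data.Nat using (ℕ; _≤_)
open import Data.Fin using (Fin)
open import Data.Vec using (Vec; replicate; map; zipWith)
open import Data.List using (List; length)
open import Data.List.Relation.Unary.All using (All)
open import Data.List.Relation.Unary.Any using (Any)
open import Data.List.Relation.Unary.AllPairs using (AllPairs)
open import Data.Product using (_×_; _,_; ∃; ∃-syntax; Σ)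
open import Data.Sum using (_⊎_)
open import Relation.Nullary using (¬_)
open import Relation.Binary.PropositionalEquality using (_≡_; _≢_)
open import Relation.Binary.Construct.Closure.ReflexiveTransitive using (Star)
open import Algebra.Core using (Op₁; Op₂)
open import Algebra.Structures using (IsCommutativeRing)
open import Function.Bundles using (_↔_)

record FiniteField : Set₁ where
  infixl 6 _+_
  infixl 7 _*_
  field
    Carrier           : Set
    _+_ _*_           : Op₂ Carrier
    -_                : Op₁ Carrier
    0# 1#             : Carrier
    isCommutativeRing : IsCommutativeRing _≡_ _+_ _*_ -_ 0# 1#
    0≢1               : 0# ≢ 1#
    inverse           : ∀ x → x ≢ 0# → ∃[ y ] (x * y ≡ 1#)
    q                 : ℕ
    enumeration       : Carrier ↔ Fin q

-- The n-dimensional vector space F^n over F (every n-dimensional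
-- F-vector space is isomorphic to it).

module _ (F : FiniteField) where
  open FiniteField F

  Vect : ℕ → Set
  Vect n = Vec Carrier n

  zeroV : ∀ {n} → Vect n
  zeroV = replicate _ 0#

  _+V_ : ∀ {n} → Vect n → Vect n → Vect n
  _+V_ = zipWith _+_

  _·V_ : ∀ {n} → Carrier → Vect n → Vect n
  c ·V v = map (c *_) v

  LinDep : ∀ {n} → Vect n → Vect n → Set
  LinDep a b = ∃[ λ₁ ] ∃[ μ ] (¬ (λ₁ ≡ 0# × μ ≡ 0#) × ((λ₁ ·V a) +V (μ ·V b)) ≡ zeroV)

  ΓAdj : ∀ {n} → Vect n → Vect n → Set
  ΓAdj a b = a ≢ b × LinDep a b

module _ {V : Set} where

  SameEdge : V × V → V × V → Set
  SameEdge (a , b) (c , d) = (a ≡ c × b ≡ d) ⊎ (a ≡ d × b ≡ c)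

  EdgeSet : (V → V → Set) → List (V × V) → Set
  EdgeSet Adj S = All (λ e → Adj (Data.Product.proj₁ e) (Data.Product.proj₂ e)) S
                × AllPairs (λ e e′ → ¬ SameEdge e e′) S

  RemoveEdges : (V → V → Set) → List (V × V) → V → V → Set
  RemoveEdges Adj S a b = Adj a b × ¬ Any (SameEdge (a , b)) S

  Connected : (V → V → Set) → Set
  Connected Adj = ∀ u v → Star Adj u v

  EdgeConnectivity : (V → V → Set) → ℕ → Set
  EdgeConnectivity Adj k =
      (∃[ S ] (EdgeSet Adj S × length S ≡ k × ¬ Connected (RemoveEdges Adj S)))
    × (∀ S → EdgeSet Adj S → ¬ Connected (RemoveEdges Adj S) → k ≤ length S)

{-# OPTIONS --safe #-}
module Submission where

-- The neighbours of e₁ are exactly its multiples c·e₁ with c ≠ 1, so removing the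
-- q − 1 edges at e₁ isolates it. Conversely, every u ≠ 0 is joined to 0 by the
-- q − 1 walks u — c·u — 0 (c ≠ 1; for c = 0 just the edge u — 0), which are
-- pairwise edge-disjoint. By pigeonhole, fewer than q − 1 edges miss one of these
-- walks, so after their removal every vertex is still joined to 0.

open import Defs
open import Data.Nat using (ℕ; suc; _≤_; _<_; _∸_)
open import Data.Nat.Properties using (≮⇒≥)
open import Data.Fin using (Fin; punchIn; punchOut)
open import Data.Fin.Properties
  using (punchInᵢ≢i; punchIn-injective; punchIn-punchOut; ¬∀⟶∃¬; pigeonhole; <⇒≢)
  renaming (_≟_ to _≟ᶠ_)
open import Data.Vec using ([]; _∷_; replicate; head)
open import Data.Vec.Properties
  using (∷-injectiveˡ; ∷-injectiveʳ; ≡-dec; map-cong; map-id; map-const;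
         map-replicate; zipWith-comm; zipWith-identityˡ)
open import Data.List using (List; length; lookup; tabulate)
open import Data.List.Properties using (length-tabulate)
open import Data.List.Relation.Unary.Any as Any using (Any; any?; index)
open import Data.List.Relation.Unary.Any.Properties using (lookup-index)
import Data.List.Relation.Unary.Any.Properties as Anyₚ
import Data.List.Relation.Unary.All.Properties as Allₚ
import Data.List.Relation.Unary.AllPairs.Properties as AllPairsₚ
open import Data.Product using (_×_; _,_; ∃; swap)
open import Data.Sum using (_⊎_; inj₁; inj₂)
open import Function using (_∘_)
open import Function.Bundles using (Inverse; Injection)
open import Function.Construct.Symmetry using (↔-sym)
open import Function.Properties.Inverse using (↔⇒↣)
open import Relation.Nullary using (¬_; Dec; yes; no; contradiction)
open import Relation.Nullary.Decidable using (via-injection; _×-dec_; _⊎-dec_)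
open import Relation.Unary using (Decidable)
open import Relation.Binary.PropositionalEquality
open import Relation.Binary.Construct.Closure.ReflexiveTransitive
  using (Star; ε; _◅_; _◅◅_; reverse)
open import Algebra.Structures using (IsCommutativeRing)

module _ {V : Set} where

  SameEdge-sym : ∀ {e e′ : V × V} → SameEdge e e′ → SameEdge e′ e
  SameEdge-sym (inj₁ (refl , refl)) = inj₁ (refl , refl)
  SameEdge-sym (inj₂ (refl , refl)) = inj₂ (refl , refl)

  SameEdge-trans : ∀ {e e′ e″ : V × V} → SameEdge e e′ → SameEdge e′ e″ → SameEdge e e″
  SameEdge-trans (inj₁ (refl , refl)) q                    = q
  SameEdge-trans (inj₂ (refl , refl)) (inj₁ (refl , refl)) = inj₂ (refl , refl)
  SameEdge-trans (inj₂ (refl , refl)) (inj₂ (refl , refl)) = inj₁ (refl , refl)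

  SameEdge-flip : ∀ {a b : V} {e} → SameEdge (b , a) e → SameEdge (a , b) e
  SameEdge-flip = SameEdge-trans (inj₂ (refl , refl))

  RemoveEdges-sym : ∀ {Adj : V → V → Set} {S} → (∀ {a b} → Adj a b → Adj b a) →
                    ∀ {a b} → RemoveEdges Adj S a b → RemoveEdges Adj S b a
  RemoveEdges-sym sym-adj (adj , ∉S) = sym-adj adj , ∉S ∘ Any.map SameEdge-flip

  connected-via-hub : ∀ {R : V → V → Set} {z} → (∀ {a b} → R a b → R b a) →
                      (∀ u → Star R u z) → Connected R
  connected-via-hub sym-R to-hub u v = to-hub u ◅◅ reverse sym-R (to-hub v)

  isolated⇒¬Star : ∀ {Adj : V → V → Set} {S x y} → x ≢ y →
                   (∀ {w} → Adj x w → Any (SameEdge (x , w)) S) →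
                   ¬ Star (RemoveEdges Adj S) x y
  isolated⇒¬Star x≢y _   ε                = x≢y refl
  isolated⇒¬Star _   cut ((adj , ∉S) ◅ _) = ∉S (cut adj)

SameEdge-map⁻ : ∀ {A B : Set} {f : A → B} → (∀ {x y} → f x ≡ f y → x ≡ y) →
                ∀ {a b a′ b′} → SameEdge (f a , f b) (f a′ , f b′) → SameEdge (a , b) (a′ , b′)
SameEdge-map⁻ f-inj (inj₁ (p , q)) = inj₁ (f-inj p , f-inj q)
SameEdge-map⁻ f-inj (inj₂ (p , q)) = inj₂ (f-inj p , f-inj q)

short-list-misses : ∀ {A : Set} {k} (P : Fin k → A → Set) → (∀ j → Decidable (P j)) →
                    (∀ {i j x} → P i x → P j x → i ≡ j) →
                    ∀ xs → length xs < k → ∃ λ j → ¬ Any (P j) xs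
short-list-misses {k = k} P P? disjoint xs short =
  ¬∀⟶∃¬ k (λ j → Any (P j) xs) (λ j → any? (P? j) xs) all-hit⇒⊥
  where
  all-hit⇒⊥ : ¬ (∀ j → Any (P j) xs)
  all-hit⇒⊥ hit with pigeonhole short (λ j → index (hit j))
  ... | i , j , i<j , same-index = <⇒≢ i<j (disjoint (lookup-index (hit i)) hit-j)
    where
    hit-j : P j (lookup xs (index (hit i)))
    hit-j = subst (λ p → P j (lookup xs p)) (sym same-index) (lookup-index (hit j))

punchIn′ : ∀ {k} → Fin k → Fin (k ∸ 1) → Fin k
punchIn′ {suc k} = punchIn

punchIn′ᵢ≢i : ∀ {k} (i : Fin k) j → punchIn′ i j ≢ i
punchIn′ᵢ≢i {suc k} = punchInᵢ≢i

punchIn′-injective : ∀ {k} (i : Fin k) {j j′} → punchIn′ i j ≡ punchIn′ i j′ → j ≡ j′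
punchIn′-injective {suc k} i = punchIn-injective i _ _

punchIn′-surjective : ∀ {k} {i x : Fin k} → x ≢ i → ∃ λ j → punchIn′ i j ≡ x
punchIn′-surjective {suc k} x≢i = punchOut (x≢i ∘ sym) , punchIn-punchOut _

module LinearDependenceGraph (F : FiniteField) where
  open FiniteField F
  open IsCommutativeRing isCommutativeRing
    using (*-comm; *-assoc; *-identityˡ; *-identityʳ; zeroˡ; zeroʳ; distribʳ;
           +-comm; +-identityˡ; +-identityʳ; -‿inverseʳ)
  open Inverse enumeration using (to; from; strictlyInverseˡ; strictlyInverseʳ)
  open ≡-Reasoning

  infixr 7 _·_

  _·_ : ∀ {n} → Carrier → Vect F n → Vect F n
  _·_ = _·V_ F

  infixl 6 _⊕_

  _⊕_ : ∀ {n} → Vect F n → Vect F n → Vect F n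
  _⊕_ = _+V_ F

  𝟎 : ∀ {n} → Vect F n
  𝟎 = zeroV F

  _≟_ : (x y : Carrier) → Dec (x ≡ y)
  _≟_ = via-injection (↔⇒↣ enumeration) _≟ᶠ_

  _≟V_ : ∀ {n} (u v : Vect F n) → Dec (u ≡ v)
  _≟V_ = ≡-dec _≟_

  SameEdge? : ∀ {n} (e e′ : Vect F n × Vect F n) → Dec (SameEdge e e′)
  SameEdge? (a , b) (c , d) =
    ((a ≟V c) ×-dec (b ≟V d)) ⊎-dec ((a ≟V d) ×-dec (b ≟V c))

  *-cancelˡ : ∀ {x a b} → x ≢ 0# → x * a ≡ x * b → a ≡ b
  *-cancelˡ {x} {a} {b} x≢0 xa≡xb with inverse x x≢0
  ... | y , xy≡1 = begin
    a             ≡⟨ sym (*-identityˡ a) ⟩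
    1# * a        ≡⟨ cong (_* a) (trans (sym xy≡1) (*-comm x y)) ⟩
    (y * x) * a   ≡⟨ *-assoc y x a ⟩
    y * (x * a)   ≡⟨ cong (y *_) xa≡xb ⟩
    y * (x * b)   ≡⟨ sym (*-assoc y x b) ⟩
    (y * x) * b   ≡⟨ cong (_* b) (trans (*-comm y x) xy≡1) ⟩
    1# * b        ≡⟨ *-identityˡ b ⟩
    b             ∎

  -a≡0⇒a≡0 : ∀ {a} → - a ≡ 0# → a ≡ 0#
  -a≡0⇒a≡0 {a} -a≡0 = begin
    a             ≡⟨ sym (+-identityʳ a) ⟩
    a + 0#        ≡⟨ cong (a +_) (sym -a≡0) ⟩
    a + - a       ≡⟨ -‿inverseʳ a ⟩
    0#            ∎

  to-injective : ∀ {a b} → to a ≡ to b → a ≡ b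
  to-injective = Injection.injective (↔⇒↣ enumeration)

  from-injective : ∀ {i j} → from i ≡ from j → i ≡ j
  from-injective = Injection.injective (↔⇒↣ (↔-sym enumeration))

  nonUnit : Fin (q ∸ 1) → Carrier
  nonUnit = from ∘ punchIn′ (to 1#)

  nonUnit≢1 : ∀ j → nonUnit j ≢ 1#
  nonUnit≢1 j eq = punchIn′ᵢ≢i (to 1#) j (trans (sym (strictlyInverseˡ _)) (cong to eq))

  nonUnit-injective : ∀ {i j} → nonUnit i ≡ nonUnit j → i ≡ j
  nonUnit-injective = punchIn′-injective (to 1#) ∘ from-injective

  nonUnit-surjective : ∀ {c} → c ≢ 1# → ∃ λ j → nonUnit j ≡ c
  nonUnit-surjective {c} c≢1 with punchIn′-surjective (c≢1 ∘ to-injective)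
  ... | j , eq = j , trans (cong from eq) (strictlyInverseʳ c)

  ·-identityˡ : ∀ {n} (u : Vect F n) → 1# · u ≡ u
  ·-identityˡ u = trans (map-cong *-identityˡ u) (map-id u)

  ·-zeroˡ : ∀ {n} (u : Vect F n) → 0# · u ≡ 𝟎
  ·-zeroˡ u = trans (map-cong zeroˡ u) (map-const u 0#)

  ·-zeroʳ : ∀ {n} c → c · 𝟎 {n} ≡ 𝟎
  ·-zeroʳ {n} c = trans (map-replicate (c *_) 0# n) (cong (replicate n) (zeroʳ c))

  ·-cancelʳ : ∀ {n} {u : Vect F n} {a b} → u ≢ 𝟎 → a · u ≡ b · u → a ≡ b
  ·-cancelʳ {u = []}    u≢0 _ = contradiction refl u≢0
  ·-cancelʳ {u = x ∷ u} u≢0 eq with x ≟ 0#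
  ... | yes refl = ·-cancelʳ (u≢0 ∘ cong (0# ∷_)) (∷-injectiveʳ eq)
  ... | no  x≢0  = *-cancelˡ x≢0 (trans (*-comm x _) (trans (∷-injectiveˡ eq) (*-comm _ x)))

  ·-cancelˡ : ∀ {n} {c} {u v : Vect F n} → c ≢ 0# → c · u ≡ c · v → u ≡ v
  ·-cancelˡ {u = []}    {[]}    _   _  = refl
  ·-cancelˡ {u = x ∷ u} {y ∷ v} c≢0 eq =
    cong₂ _∷_ (*-cancelˡ c≢0 (∷-injectiveˡ eq)) (·-cancelˡ c≢0 (∷-injectiveʳ eq))

  combination-of-multiples : ∀ {n} (u : Vect F n) {l m a b} → l * a + m * b ≡ 0# →
                             l · a · u ⊕ m · b · u ≡ 𝟎
  combination-of-multiples []      _  = refl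
  combination-of-multiples (x ∷ u) {l} {m} {a} {b} la+mb≡0 =
    cong₂ _∷_ head≡0 (combination-of-multiples u la+mb≡0)
    where
    head≡0 : l * (a * x) + m * (b * x) ≡ 0#
    head≡0 = begin
      l * (a * x) + m * (b * x)   ≡⟨ cong₂ _+_ (sym (*-assoc l a x)) (sym (*-assoc m b x)) ⟩
      (l * a) * x + (m * b) * x   ≡⟨ sym (distribʳ x (l * a) (m * b)) ⟩
      (l * a + m * b) * x         ≡⟨ cong (_* x) la+mb≡0 ⟩
      0# * x                      ≡⟨ zeroˡ x ⟩
      0#                          ∎

  ΓAdj-sym : ∀ {n} {a b : Vect F n} → ΓAdj F a b → ΓAdj F b a
  ΓAdj-sym (a≢b , l , m , nontrivial , eq) =
    a≢b ∘ sym , m , l , nontrivial ∘ swap , trans (zipWith-comm +-comm _ _) eq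

  ΓAdj-multiples : ∀ {n} {u : Vect F n} {a b} → u ≢ 𝟎 → a ≢ b → ΓAdj F (a · u) (b · u)
  ΓAdj-multiples {u = u} {a} {b} u≢0 a≢b =
    a≢b ∘ ·-cancelʳ u≢0 , b , - a , nontrivial , combination-of-multiples u ba-ab≡0
    where
    nontrivial : ¬ (b ≡ 0# × - a ≡ 0#)
    nontrivial (b≡0 , -a≡0) = a≢b (trans (-a≡0⇒a≡0 -a≡0) (sym b≡0))
    ba-ab≡0 : b * a + - a * b ≡ 0#
    ba-ab≡0 = begin
      b * a + - a * b   ≡⟨ cong (_+ - a * b) (*-comm b a) ⟩
      a * b + - a * b   ≡⟨ sym (distribʳ b a (- a)) ⟩
      (a + - a) * b     ≡⟨ cong (_* b) (-‿inverseʳ a) ⟩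
      0# * b            ≡⟨ zeroˡ b ⟩
      0#                ∎

  -- For c = 0 the second pair is the loop at 0·u, which is no edge of Γ and lies on
  -- no other route.
  OnRoute : ∀ {n} → Vect F n → Carrier → Vect F n × Vect F n → Set
  OnRoute u c s = SameEdge (1# · u , c · u) s ⊎ SameEdge (c · u , 0# · u) s

  OnRoute? : ∀ {n} (u : Vect F n) c → Decidable (OnRoute u c)
  OnRoute? u c s = SameEdge? (1# · u , c · u) s ⊎-dec SameEdge? (c · u , 0# · u) s

  SameEdge-multiples : ∀ {n} {u : Vect F n} {a b a′ b′ s} → u ≢ 𝟎 →
                       SameEdge (a · u , b · u) s → SameEdge (a′ · u , b′ · u) s →
                       SameEdge (a , b) (a′ , b′)
  SameEdge-multiples u≢0 e e′ = SameEdge-map⁻ (·-cancelʳ u≢0) (SameEdge-trans e (SameEdge-sym e′))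

  OnRoute-unique : ∀ {n} {u : Vect F n} {c c′ s} → u ≢ 𝟎 → c ≢ 1# → c′ ≢ 1# →
                   OnRoute u c s → OnRoute u c′ s → c ≡ c′
  OnRoute-unique u≢0 c≢1 c′≢1 (inj₁ p) (inj₁ p′) with SameEdge-multiples u≢0 p p′
  ... | inj₁ (_ , c≡c′)    = c≡c′
  ... | inj₂ (1≡c′ , _)    = contradiction (sym 1≡c′) c′≢1
  OnRoute-unique u≢0 c≢1 c′≢1 (inj₁ p) (inj₂ p′) with SameEdge-multiples u≢0 p p′
  ... | inj₁ (1≡c′ , _)    = contradiction (sym 1≡c′) c′≢1
  ... | inj₂ (_ , c≡c′)    = c≡c′
  OnRoute-unique u≢0 c≢1 c′≢1 (inj₂ p) (inj₁ p′) with SameEdge-multiples u≢0 p p′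
  ... | inj₁ (c≡1 , _)     = contradiction c≡1 c≢1
  ... | inj₂ (c≡c′ , _)    = c≡c′
  OnRoute-unique u≢0 c≢1 c′≢1 (inj₂ p) (inj₂ p′) with SameEdge-multiples u≢0 p p′
  ... | inj₁ (c≡c′ , _)    = c≡c′
  ... | inj₂ (c≡0 , 0≡c′)  = trans c≡0 0≡c′

  nonUnit-routes-disjoint : ∀ {n} {u : Vect F n} {i j s} → u ≢ 𝟎 →
                            OnRoute u (nonUnit i) s → OnRoute u (nonUnit j) s → i ≡ j
  nonUnit-routes-disjoint u≢0 p p′ =
    nonUnit-injective (OnRoute-unique u≢0 (nonUnit≢1 _) (nonUnit≢1 _) p p′)

  route-avoiding : ∀ {n} {u : Vect F n} {c} S → u ≢ 𝟎 → c ≢ 1# → ¬ Any (OnRoute u c) S →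
                   Star (RemoveEdges (ΓAdj F) S) (1# · u) (0# · u)
  route-avoiding {c = c} S u≢0 c≢1 avoids with c ≟ 0#
  ... | yes refl = (ΓAdj-multiples u≢0 (c≢1 ∘ sym) , avoids ∘ Any.map inj₁) ◅ ε
  ... | no  c≢0  = (ΓAdj-multiples u≢0 (c≢1 ∘ sym) , avoids ∘ Any.map inj₁)
                 ◅ (ΓAdj-multiples u≢0 c≢0 , avoids ∘ Any.map inj₂) ◅ ε

  connected-after-removing-fewer : ∀ {n} S → length S < q ∸ 1 →
                                   Connected (RemoveEdges (ΓAdj F {n}) S)
  connected-after-removing-fewer S short =
    connected-via-hub (RemoveEdges-sym ΓAdj-sym) to-zero
    where
    to-zero : ∀ u → Star (RemoveEdges (ΓAdj F) S) u 𝟎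
    to-zero u with u ≟V 𝟎
    ... | yes refl = ε
    ... | no  u≢0  =
      let j , avoids = short-list-misses (OnRoute u ∘ nonUnit) (OnRoute? u ∘ nonUnit)
                         (nonUnit-routes-disjoint u≢0) S short
      in  subst₂ (Star _) (·-identityˡ u) (·-zeroˡ u) (route-avoiding S u≢0 (nonUnit≢1 j) avoids)

  e₁ : ∀ {m} → Vect F (suc m)
  e₁ = 1# ∷ replicate _ 0#

  e₁≢0 : ∀ {m} → e₁ {m} ≢ 𝟎
  e₁≢0 = 0≢1 ∘ sym ∘ ∷-injectiveˡ

  LinDep-e₁ : ∀ {m} {w : Vect F (suc m)} → LinDep F e₁ w → w ≡ head w · e₁
  LinDep-e₁ {w = w₀ ∷ ws} (l , μ , nontrivial , eq) =
    cong₂ _∷_ (sym (*-identityʳ w₀)) (trans ws≡0 (sym (·-zeroʳ w₀)))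
    where
    head-eq : l * 1# + μ * w₀ ≡ 0#
    head-eq = ∷-injectiveˡ eq
    μ≢0 : μ ≢ 0#
    μ≢0 refl = nontrivial (l≡0 , refl)
      where
      l≡0 : l ≡ 0#
      l≡0 = begin
        l                  ≡⟨ sym (*-identityʳ l) ⟩
        l * 1#             ≡⟨ sym (+-identityʳ _) ⟩
        l * 1# + 0#        ≡⟨ cong (l * 1# +_) (sym (zeroˡ w₀)) ⟩
        l * 1# + 0# * w₀   ≡⟨ head-eq ⟩
        0#                 ∎
    μws≡0 : μ · ws ≡ 𝟎
    μws≡0 = begin
      μ · ws            ≡⟨ sym (zipWith-identityˡ +-identityˡ _) ⟩
      𝟎 ⊕ μ · ws        ≡⟨ cong (_⊕ μ · ws) (sym (·-zeroʳ l)) ⟩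
      l · 𝟎 ⊕ μ · ws    ≡⟨ ∷-injectiveʳ eq ⟩
      𝟎                 ∎
    ws≡0 : ws ≡ 𝟎
    ws≡0 = ·-cancelˡ μ≢0 (trans μws≡0 (sym (·-zeroʳ μ)))

  neighbour-of-e₁ : ∀ {m} {w : Vect F (suc m)} → ΓAdj F e₁ w → ∃ λ j → w ≡ nonUnit j · e₁
  neighbour-of-e₁ {w = w} (e₁≢w , dep) =
    let j , nonUnit-j≡head = nonUnit-surjective head≢1
    in  j , trans (LinDep-e₁ dep) (cong (_· e₁) (sym nonUnit-j≡head))
    where
    head≢1 : head w ≢ 1#
    head≢1 refl = e₁≢w (sym (trans (LinDep-e₁ dep) (·-identityˡ e₁)))

  cut : ∀ m → List (Vect F (suc m) × Vect F (suc m))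
  cut m = tabulate λ j → e₁ , nonUnit j · e₁

  cut-isEdgeSet : ∀ m → EdgeSet (ΓAdj F) (cut m)
  cut-isEdgeSet m = Allₚ.tabulate⁺ adjacent , AllPairsₚ.tabulate⁺ distinct
    where
    adjacent : ∀ j → ΓAdj F e₁ (nonUnit j · e₁)
    adjacent j = subst (λ v → ΓAdj F v (nonUnit j · e₁)) (·-identityˡ e₁)
                   (ΓAdj-multiples e₁≢0 (nonUnit≢1 j ∘ sym))
    distinct : ∀ {i j} → i ≢ j → ¬ SameEdge (e₁ , nonUnit i · e₁) (e₁ , nonUnit j · e₁)
    distinct i≢j (inj₁ (_ , eq)) = i≢j (nonUnit-injective (·-cancelʳ e₁≢0 eq))
    distinct {j = j} _ (inj₂ (eq , _)) =
      nonUnit≢1 j (sym (·-cancelʳ e₁≢0 (trans (·-identityˡ e₁) eq)))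

  cut-disconnects : ∀ m → ¬ Connected (RemoveEdges (ΓAdj F) (cut m))
  cut-disconnects m connected = isolated⇒¬Star e₁≢0 in-cut (connected e₁ 𝟎)
    where
    in-cut : ∀ {w} → ΓAdj F e₁ w → Any (SameEdge (e₁ , w)) (cut m)
    in-cut adj with neighbour-of-e₁ adj
    ... | j , refl = Anyₚ.tabulate⁺ j (inj₁ (refl , refl))

mainTheorem9 : (F : FiniteField) (n : ℕ) → 1 ≤ n →
    EdgeConnectivity (ΓAdj F {n}) (FiniteField.q F ∸ 1)
mainTheorem9 F (suc m) _ =
  (cut m , cut-isEdgeSet m , length-tabulate _ , cut-disconnects m) ,
  λ S _ disconnected → ≮⇒≥ (disconnected ∘ connected-after-removing-fewer S)
  where open LinearDependenceGraph F
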